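{- Let $E$ be a regular-oriented word equation. Then the counter system $\mathcal{C}(E)$ is flat and each of its simple cycles is 1-variable-reducing. Moreover, every simple cycle in the control structure of $\mathcal{C}(E)$ has length $O(|E|)$ and every simple path in it has length $O(|E|^2)$, where $|E|$ is the total length of both sides of $E$.
   Context: Word equations $L=R$, $L,R\in(A\cup V)^*$ ($A$ constants, $V$ variables, disjoint). Regular: each variable occurs at most once in $L$ and at most once in $R$. Oriented: there is a total order $<$ on $V$ such that for $w\in\{L,R\}$, whenever $w=w_1\alpha w_2\beta w_3$ with $\alpha,\beta\in V$, then $\alpha<\beta$. $w[u/y]$ replaces each occurrence of variable $y$ in $w$ by $u$. Nielsen rewriting: for $E$ of the form $\alpha w_1=\beta w_2$ with $\alpha,\beta\in A\cup V$, $E\Rightarrow E'$ when: (erase) $\alpha\in V$, $E'=(w_1=\beta w_2)[\epsilon/\alpha]$, or symmetrically for $\beta\in V$; (P1) $\alpha,\beta$ the same symbol, $E'$ is $w_1=w_2$; (P2) $\alpha\in A,\beta\in V$, $E'$ is $w_1[\alpha\beta/\beta]=\beta\,w_2[\alpha\beta/\beta]$; (P3) $\alpha\in V,\beta\in A$, $E'$ is $\alpha\,w_1[\beta\alpha/\alpha]=w_2[\beta\alpha/\alpha]$; (P4) $\alpha,\beta$ distinct variables, $E'$ is $w_1[\alpha\beta/\beta]=\beta\,w_2[\alpha\beta/\beta]$ (case $\alpha\preceq\beta$) or $\alpha\,w_1[\beta\alpha/\alpha]=w_2[\beta\alpha/\alpha]$ (case $\beta\preceq\alpha$). Counter systems $(X,Q,\Delta)$: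 transitions $(q,\Phi(\bar x,\bar x'),q')$ with $\Phi$ Presburger; the control structure is the graph on $Q$ with one edge per transition; the system is flat if each node lies on at most one simple cycle. $\mathrm{ID}$: $\bigwedge_x x'=x$; $\mathrm{SUB}_{y,z}$: $0<z\le y\wedge y'=y-z\wedge\bigwedge_{x\ne y}x'=x$; $\mathrm{DEC}_y$: $y>0\wedge y'=y-1\wedge\bigwedge_{x\ne y}x'=x$. A simple cycle is 1-variable-reducing if for some counter $y$ each transition on it is $\mathrm{DEC}_y$ or $\mathrm{SUB}_{y,z}$ with $z\ne y$. $\mathcal{C}(E)$ has counters $V$, control states all $E'$ with $E\Rightarrow^*E'$, and for each step $E_1\Rightarrow E_2$ a transition $(E_1,\Phi,E_2)$ with $\Phi$: $y=0\wedge\mathrm{ID}$ for erasing $y$; $\mathrm{ID}$ for (P1); $\mathrm{DEC}_\beta$ for (P2); $\mathrm{DEC}_\alpha$ for (P3); $\mathrm{SUB}_{\beta,\alpha}$ for (P4) case $\alpha\preceq\beta$; $\mathrm{SUB}_{\alpha,\beta}$ for (P4) case $\beta\preceq\alpha$. -}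

module Defs where

open import Data.Nat using (ℕ; _+_; _*_; _≤_)
open import Data.List using (List; []; _∷_; _++_; length; map)
open import Data.List.Relation.Unary.All using (All)
open import Data.List.Relation.Unary.AllPairs using (AllPairs)
open import Data.Product using (Σ; ∃; _×_; _,_; proj₁; proj₂)
open import Data.Sum using (_⊎_)
open import Data.Empty using (⊥)
open import Data.Unit using (⊤)
open import Relation.Binary.PropositionalEquality using (_≡_; _≢_)
open import Relation.Binary.Construct.Closure.ReflexiveTransitive using (Star)
open import Relation.Nullary using (¬_)

data Sym (A V : Set) : Set where
  con : A → Sym A V
  var : V → Sym A V

Word : Set → Set → Set
Word A V = List (Sym A V)

record Eqn (A V : Set) : Set where
  constructor _≐_
  field
    lhs : Word A V
    rhs : Word A V
open Eqn public

size : {A V : Set} → Eqn A V → ℕ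
size (L ≐ R) = length L + length R

AtMostOnce : {A V : Set} → Word A V → Set
AtMostOnce {A} {V} w =
  (y : V) (w₁ w₂ w₃ : Word A V) → ¬ (w ≡ w₁ ++ var y ∷ w₂ ++ var y ∷ w₃)

Regular : {A V : Set} → Eqn A V → Set
Regular E = AtMostOnce (lhs E) × AtMostOnce (rhs E)

record StrictTotalOrder {V : Set} (_<_ : V → V → Set) : Set where
  field
    irrefl : (x : V) → ¬ (x < x)
    trans  : {x y z : V} → x < y → y < z → x < z
    total  : (x y : V) → x ≢ y → (x < y) ⊎ (y < x)

OrderedBy : {A V : Set} → (V → V → Set) → Word A V → Set
OrderedBy {A} {V} _<_ w =
  (w₁ w₂ w₃ : Word A V) (α β : V) → w ≡ w₁ ++ var α ∷ w₂ ++ var β ∷ w₃ → α < β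

Oriented : {A V : Set} → Eqn A V → Set₁
Oriented {A} {V} E =
  Σ (V → V → Set) λ _<_ →
    StrictTotalOrder _<_ × OrderedBy _<_ (lhs E) × OrderedBy _<_ (rhs E)

RegularOriented : {A V : Set} → Eqn A V → Set₁
RegularOriented E = Regular E × Oriented E

-- Substitution w[u/y], as a (functional) relation: Subst y u w w'
-- means w' = w[u/y] (every occurrence of var y in w replaced by u).

data Subst {A V : Set} (y : V) (u : Word A V) : Word A V → Word A V → Set where
  []  : Subst y u [] []
  hit : {w w' : Word A V} → Subst y u w w' → Subst y u (var y ∷ w) (u ++ w')
  miss : {s : Sym A V} {w w' : Word A V} → s ≢ var y →
         Subst y u w w' → Subst y u (s ∷ w) (s ∷ w')

data Formula (V : Set) : Set where
  zeroID : V → Formula V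
  ID     : Formula V
  DEC    : V → Formula V
  SUB    : V → V → Formula V

-- Nielsen rewriting, labelled with the formula of the corresponding
-- transition of C(E):  Step E Φ E'  iff  E ⇒ E' by a rule whose
-- transition formula is Φ.

data Step {A V : Set} : Eqn A V → Formula V → Eqn A V → Set where
  eraseL : {x : V} {β : Sym A V} {w₁ w₂ L' R' : Word A V} →
           Subst x [] w₁ L' → Subst x [] (β ∷ w₂) R' →
           Step ((var x ∷ w₁) ≐ (β ∷ w₂)) (zeroID x) (L' ≐ R')
  eraseR : {y : V} {α : Sym A V} {w₁ w₂ L' R' : Word A V} →
           Subst y [] (α ∷ w₁) L' → Subst y [] w₂ R' →
           Step ((α ∷ w₁) ≐ (var y ∷ w₂)) (zeroID y) (L' ≐ R')
  P1 : {α : Sym A V} {w₁ w₂ : Word A V} →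
       Step ((α ∷ w₁) ≐ (α ∷ w₂)) ID (w₁ ≐ w₂)
  P2 : {a : A} {y : V} {w₁ w₂ L' R' : Word A V} →
       Subst y (con a ∷ var y ∷ []) w₁ L' → Subst y (con a ∷ var y ∷ []) w₂ R' →
       Step ((con a ∷ w₁) ≐ (var y ∷ w₂)) (DEC y) (L' ≐ (var y ∷ R'))
  P3 : {x : V} {b : A} {w₁ w₂ L' R' : Word A V} →
       Subst x (con b ∷ var x ∷ []) w₁ L' → Subst x (con b ∷ var x ∷ []) w₂ R' →
       Step ((var x ∷ w₁) ≐ (con b ∷ w₂)) (DEC x) ((var x ∷ L') ≐ R')
  P4a : {x y : V} {w₁ w₂ L' R' : Word A V} → x ≢ y →
        Subst y (var x ∷ var y ∷ []) w₁ L' → Subst y (var x ∷ var y ∷ []) w₂ R' →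
        Step ((var x ∷ w₁) ≐ (var y ∷ w₂)) (SUB y x) (L' ≐ (var y ∷ R'))
  P4b : {x y : V} {w₁ w₂ L' R' : Word A V} → x ≢ y →
        Subst x (var y ∷ var x ∷ []) w₁ L' → Subst x (var y ∷ var x ∷ []) w₂ R' →
        Step ((var x ∷ w₁) ≐ (var y ∷ w₂)) (SUB x y) ((var x ∷ L') ≐ R')

_⇒_ : {A V : Set} → Eqn A V → Eqn A V → Set
E ⇒ E' = ∃ λ Φ → Step E Φ E'

_⇒*_ : {A V : Set} → Eqn A V → Eqn A V → Set
_⇒*_ = Star _⇒_

Trans : Set → Set → Set
Trans A V = Eqn A V × Formula V × Eqn A V

src : {A V : Set} → Trans A V → Eqn A V
src (E₁ , _ , _) = E₁

lbl : {A V : Set} → Trans A V → Formula V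
lbl (_ , Φ , _) = Φ

tgt : {A V : Set} → Trans A V → Eqn A V
tgt (_ , _ , E₂) = E₂

-- t is a transition of C(E) (= an edge of its control structure):
-- its source is a control state (reachable from E) and it comes from a
-- rewriting step.
IsTransition : {A V : Set} → Eqn A V → Trans A V → Set
IsTransition E (E₁ , Φ , E₂) = (E ⇒* E₁) × Step E₁ Φ E₂

Chained : {A V : Set} → List (Trans A V) → Set
Chained []           = ⊤
Chained (t ∷ [])     = ⊤
Chained (t ∷ u ∷ ts) = (tgt t ≡ src u) × Chained (u ∷ ts)

IsPath : {A V : Set} → Eqn A V → List (Trans A V) → Set
IsPath E ts = All (IsTransition E) ts × Chained ts

vertices : {A V : Set} → List (Trans A V) → List (Eqn A V)
vertices []       = []
vertices (t ∷ ts) = src t ∷ map tgt (t ∷ ts)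

-- simple path: all visited vertices pairwise distinct; length = #edges
SimplePath : {A V : Set} → Eqn A V → List (Trans A V) → Set
SimplePath E ts = IsPath E ts × AllPairs _≢_ (vertices ts)

lastTgt : {A V : Set} → Trans A V → List (Trans A V) → Eqn A V
lastTgt t []       = tgt t
lastTgt t (u ∷ us) = lastTgt u us

Closed : {A V : Set} → List (Trans A V) → Set
Closed []       = ⊥
Closed (t ∷ ts) = lastTgt t ts ≡ src t

SimpleCycle : {A V : Set} → Eqn A V → List (Trans A V) → Set
SimpleCycle E ts = IsPath E ts × Closed ts × AllPairs _≢_ (map src ts)

StartsAt : {A V : Set} → Eqn A V → List (Trans A V) → Set
StartsAt v []       = ⊥
StartsAt v (t ∷ ts) = src t ≡ v

-- flat: each node lies on at most one simple cycle.  A simple cycle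
-- through v has a unique rotation starting at v, so this says: any two
-- simple cycles starting at v coincide.
Flat : {A V : Set} → Eqn A V → Set
Flat {A} {V} E =
  (v : Eqn A V) (c₁ c₂ : List (Trans A V)) →
  SimpleCycle E c₁ → SimpleCycle E c₂ → StartsAt v c₁ → StartsAt v c₂ →
  c₁ ≡ c₂

OneVarReducing : {A V : Set} → List (Trans A V) → Set
OneVarReducing {A} {V} c =
  Σ V λ y → All (λ t → (lbl t ≡ DEC y) ⊎ (Σ V λ z → (z ≢ y) × (lbl t ≡ SUB y z))) c

-- Call an equation coherent if no variable occurs twice on one side and no
-- two variables occur in opposite orders on the two sides.  Oriented
-- equations are coherent, and Nielsen steps preserve coherence.  In a
-- coherent equation every step either shortens the equation or is a slide:
-- the equation reads  s u y v = y w  (or its mirror image), the substitution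
-- y ↦ s y turns it into  u s y v = y w,  and the label is DEC y or SUB y x.
-- Slides are deterministic, keep the pivot y, and rotate the block s u, so a
-- run of slides without repeated states has length at most |s u| < |E|.
-- Since no step lengthens an equation, a cycle consists of slides only; this
-- gives flatness, 1-variable-reduction and the linear bound.  A simple path
-- alternates runs of slides with shortening steps, whence the quadratic bound.
module Submission where

open import Defs
open import Data.Nat using (ℕ; zero; suc; _+_; _*_; _≤_; _<_; z≤n; s≤s; pred)
open import Data.Nat.Properties
  using (≤-refl; ≤-reflexive; ≤-trans; <⇒≤; <⇒≱; ≤-<-trans; <-≤-trans; n<1+n; n≤1+n;
         m≤m+n; m<m+n; +-suc; +-comm; +-monoʳ-≤; +-mono-≤; +-mono-<-≤; +-mono-≤-<;
         *-monoʳ-≤; *-identityˡ; <⇒≤pred; pred-mono-≤; pred[n]≤n; module ≤-Reasoning)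
open import Data.List using (List; []; _∷_; _++_; _∷ʳ_; [_]; length; map)
open import Data.List.Properties
  using (++-assoc; ++-identityʳ; length-++; length-++-sucʳ; map-++; ∷-injective)
open import Data.List.Membership.Propositional using (_∈_; _∉_)
open import Data.List.Membership.Propositional.Properties
  using (∈-++⁺ˡ; ∈-++⁺ʳ; ∈-++⁻; ∈-∃++)
open import Data.List.Relation.Unary.Any using (here; there)
open import Data.List.Relation.Unary.All using (All; []; _∷_)
open import Data.List.Relation.Unary.All.Properties using (++⁻ˡ)
open import Data.List.Relation.Unary.AllPairs using (AllPairs; []; _∷_)
open import Data.List.Relation.Unary.Unique.Propositional using (Unique)
open import Data.Product using (Σ; ∃₂; _×_; _,_; proj₁; proj₂)
open import Data.Sum using (_⊎_; inj₁; inj₂)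
open import Data.Empty using (⊥; ⊥-elim)
open import Relation.Nullary using (¬_)
open import Relation.Binary.PropositionalEquality
  using (_≡_; _≢_; refl; sym; trans; cong; subst; subst₂; module ≡-Reasoning)
open import Relation.Binary.Construct.Closure.ReflexiveTransitive using (ε; _◅_)

AllPairs-++⁻ : ∀ {X : Set} {R : X → X → Set} (xs : List X) {ys : List X} →
               AllPairs R (xs ++ ys) → AllPairs R xs × AllPairs R ys
AllPairs-++⁻ []       rs       = [] , rs
AllPairs-++⁻ (x ∷ xs) (r ∷ rs) with rsₗ , rsᵣ ← AllPairs-++⁻ xs rs =
  (++⁻ˡ xs r ∷ rsₗ) , rsᵣ

m+[1+m*m]≤[1+m]*[1+m] : ∀ m → m + suc (m * m) ≤ suc m * suc m
m+[1+m*m]≤[1+m]*[1+m] m = begin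
  m + suc (m * m)     ≡⟨ +-suc m (m * m) ⟩
  suc (m + m * m)     ≤⟨ s≤s (+-monoʳ-≤ m (*-monoʳ-≤ m (n≤1+n m))) ⟩
  suc (m + m * suc m) ∎
  where open ≤-Reasoning

pred[n]≤n*n : ∀ n → pred n ≤ n * n
pred[n]≤n*n zero    = z≤n
pred[n]≤n*n (suc m) = ≤-trans (m≤m+n m _) (m+[1+m*m]≤[1+m]*[1+m] m)

module _ {A V : Set} where

  private
    variable
      x y : V
      s : Sym A V
      b u v w w′ w₁ w₂ L′ R′ : Word A V
      E S T T′ : Eqn A V
      Φ Ψ : Formula V
      p : List (Trans A V)

  data Precedes (x y : V) : Word A V → Set where
    first : var y ∈ w → Precedes x y (var x ∷ w)
    later : Precedes x y w → Precedes x y (s ∷ w)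

  NoRepeat : Word A V → Set
  NoRepeat w = ∀ z → ¬ Precedes z z w

  SameOrder : Word A V → Word A V → Set
  SameOrder l r = ∀ a b → Precedes a b l → Precedes b a r → ⊥

  Coherent : Eqn A V → Set
  Coherent (l ≐ r) = NoRepeat l × NoRepeat r × SameOrder l r

  precedes-∈ˡ : ∀ {a b} → Precedes a b w → var a ∈ w
  precedes-∈ˡ (first _) = here refl
  precedes-∈ˡ (later q) = there (precedes-∈ˡ q)

  precedes-split : ∀ {a b} → Precedes a b w →
                   Σ (Word A V) λ w₁ → ∃₂ λ w₂ w₃ →
                   w ≡ w₁ ++ var a ∷ w₂ ++ var b ∷ w₃
  precedes-split (first m) with w₂ , w₃ , refl ← ∈-∃++ m = [] , w₂ , w₃ , refl
  precedes-split (later {s = s} q) with w₁ , w₂ , w₃ , refl ← precedes-split q =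
    s ∷ w₁ , w₂ , w₃ , refl

  precedes-moved : ∀ {a b} u → Precedes a b (u ++ s ∷ w) →
                   Precedes a b (s ∷ u ++ w) ⊎ (s ≡ var b × var a ∈ u)
  precedes-moved []      q = inj₁ q
  precedes-moved (_ ∷ u) (first m) with ∈-++⁻ u m
  ... | inj₁ b∈u         = inj₁ (later (first (∈-++⁺ˡ b∈u)))
  ... | inj₂ (here refl) = inj₂ (refl , here refl)
  ... | inj₂ (there b∈w) = inj₁ (later (first (∈-++⁺ʳ u b∈w)))
  precedes-moved (_ ∷ u) (later q) with precedes-moved u q
  ... | inj₁ (first m)  = inj₁ (first (there m))
  ... | inj₁ (later q′) = inj₁ (later (later q′))
  ... | inj₂ (e , a∈u)  = inj₂ (e , there a∈u)

  coherent-swap : ∀ {l r} → Coherent (l ≐ r) → Coherent (r ≐ l)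
  coherent-swap (nrₗ , nrᵣ , ord) = nrᵣ , nrₗ , λ a b q q′ → ord b a q′ q

  coherent-mono : ∀ {l r l′ r′} →
                  (∀ {a b} → Precedes a b l′ → Precedes a b l) →
                  (∀ {a b} → Precedes a b r′ → Precedes a b r) →
                  Coherent (l ≐ r) → Coherent (l′ ≐ r′)
  coherent-mono f g (nrₗ , nrᵣ , ord) =
    (λ z q → nrₗ z (f q)) , (λ z q → nrᵣ z (g q)) , (λ a b q q′ → ord a b (f q) (g q′))

  coherent-slide : s ≢ var y → Coherent ((s ∷ u ++ var y ∷ v) ≐ (var y ∷ w)) →
                   Coherent ((u ++ s ∷ var y ∷ v) ≐ (var y ∷ w))
  coherent-slide {y = y} {u = u} s≢y (nrₗ , nrᵣ , ord) = nrₗ′ , nrᵣ , ord′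
    where
    nrₗ′ : NoRepeat _
    nrₗ′ z q with precedes-moved u q
    ... | inj₁ q′           = nrₗ z q′
    ... | inj₂ (refl , z∈u) = nrₗ z (first (∈-++⁺ˡ z∈u))
    ord′ : SameOrder _ _
    ord′ a b q q′ with precedes-moved u q | q′
    ... | inj₁ q″         | _         = ord a b q″ q′
    ... | inj₂ (refl , _) | first _   = s≢y refl
    ... | inj₂ (refl , _) | later q″ =
      ord b y (first (∈-++⁺ʳ u (here refl))) (first (precedes-∈ˡ q″))

  oriented⇒coherent : Oriented E → Coherent E
  oriented⇒coherent (_<_ , order , ordₗ , ordᵣ) =
    (λ z q → irrefl z (ordered ordₗ q)) ,
    (λ z q → irrefl z (ordered ordᵣ q)) ,
    (λ a b q q′ → irrefl a (<-trans (ordered ordₗ q) (ordered ordᵣ q′)))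
    where
    open StrictTotalOrder order renaming (trans to <-trans)
    ordered : ∀ {a b} → OrderedBy _<_ w → Precedes a b w → a < b
    ordered o q with w₁ , w₂ , w₃ , e ← precedes-split q = o w₁ w₂ w₃ _ _ e

  erase-∈ : ∀ {z} → Subst y [] w w′ → z ∈ w′ → z ∈ w
  erase-∈ (hit θ)    m         = there (erase-∈ θ m)
  erase-∈ (miss _ θ) (here e)  = here e
  erase-∈ (miss _ θ) (there m) = there (erase-∈ θ m)

  erase-precedes : ∀ {a b} → Subst y [] w w′ → Precedes a b w′ → Precedes a b w
  erase-precedes (hit θ)    q         = later (erase-precedes θ q)
  erase-precedes (miss _ θ) (first m) = first (erase-∈ θ m)
  erase-precedes (miss _ θ) (later q) = later (erase-precedes θ q)

  erase-length : Subst y [] w w′ → length w′ ≤ length w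
  erase-length []         = z≤n
  erase-length (hit θ)    = ≤-trans (erase-length θ) (n≤1+n _)
  erase-length (miss _ θ) = s≤s (erase-length θ)

  subst-absent : Subst y u w w′ → var y ∉ w → w′ ≡ w
  subst-absent []         _   = refl
  subst-absent (hit _)    y∉w = ⊥-elim (y∉w (here refl))
  subst-absent (miss _ θ) y∉w = cong (_ ∷_) (subst-absent θ (λ m → y∉w (there m)))

  subst-once : NoRepeat w → Subst y u w w′ →
               w′ ≡ w ⊎ ∃₂ λ w₁ w₂ →
                        w ≡ w₁ ++ var y ∷ w₂ × w′ ≡ w₁ ++ u ++ w₂
  subst-once nr []      = inj₁ refl
  subst-once nr (hit θ) =
    inj₂ ([] , _ , refl , cong (_ ++_) (subst-absent θ (λ m → nr _ (first m))))
  subst-once nr (miss {s = c} _ θ) with subst-once (λ z q → nr z (later q)) θ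
  ... | inj₁ e = inj₁ (cong (c ∷_) e)
  ... | inj₂ (w₁ , w₂ , e₁ , e₂) =
    inj₂ (c ∷ w₁ , w₂ , cong (c ∷_) e₁ , cong (c ∷_) e₂)

  data Reduction (y : V) : Sym A V → Formula V → Set where
    dec : ∀ {a} → Reduction y (con a) (DEC y)
    sub : x ≢ y → Reduction y (var x) (SUB y x)

  Reduces : V → Formula V → Set
  Reduces y Φ = Φ ≡ DEC y ⊎ Σ V λ z → z ≢ y × Φ ≡ SUB y z

  reduction-≢ : Reduction y s Φ → s ≢ var y
  reduction-≢ dec       ()
  reduction-≢ (sub x≢y) refl = x≢y refl

  reduction-unique : Reduction y s Φ → Reduction y s Ψ → Φ ≡ Ψ
  reduction-unique dec     dec     = refl
  reduction-unique (sub _) (sub _) = refl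

  reduction-reduces : Reduction y s Φ → Reduces y Φ
  reduction-reduces dec                 = inj₁ refl
  reduction-reduces (sub {x = x} x≢y) = inj₂ (x , x≢y , refl)

  data Side : Set where
    left right : Side

  flip : Side → Side
  flip left  = right
  flip right = left

  place : Side → Word A V → Word A V → Eqn A V
  place left  l r = l ≐ r
  place right l r = r ≐ l

  side-cases : ∀ σ σ′ → σ′ ≡ σ ⊎ σ′ ≡ flip σ
  side-cases left  left  = inj₁ refl
  side-cases left  right = inj₂ refl
  side-cases right left  = inj₂ refl
  side-cases right right = inj₁ refl

  place-injective : ∀ σ {l r l′ r′} → place σ l r ≡ place σ l′ r′ →
                    l ≡ l′ × r ≡ r′
  place-injective left  refl = refl , refl
  place-injective right refl = refl , refl

  place-flip : ∀ σ {l r l′ r′} → place σ l r ≡ place (flip σ) l′ r′ →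
               l ≡ r′ × r ≡ l′
  place-flip left  refl = refl , refl
  place-flip right refl = refl , refl

  coherent-unplace : ∀ σ {l r} → Coherent (place σ l r) → Coherent (l ≐ r)
  coherent-unplace left  c = c
  coherent-unplace right c = coherent-swap c

  size-place : ∀ σ l r → size (place σ l r) ≡ length l + length r
  size-place left  l r = refl
  size-place right l r = +-comm (length r) (length l)

  record Frame : Set where
    constructor frame
    field
      side   : Side
      pivot  : V
      suffix : Word A V
      other  : Word A V
  open Frame

  config : Frame → Word A V → Eqn A V
  config F b = place (side F) (b ++ var (pivot F) ∷ suffix F) (var (pivot F) ∷ other F)

  data Slide (S : Eqn A V) (Φ : Formula V) (T : Eqn A V) : Set where
    slide : ∀ F s u → S ≡ config F (s ∷ u) → T ≡ config F (u ∷ʳ s) →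
            Reduction (pivot F) s Φ → Slide S Φ T

  IsSlide : Trans A V → Set
  IsSlide t = Slide (src t) (lbl t) (tgt t)

  block-shorter : ∀ F b → length b < size (config F b)
  block-shorter (frame σ y v w) b = begin-strict
    length b                                      <⟨ m<m+n (length b) (s≤s z≤n) ⟩
    length b + length (var y ∷ v)                 ≡⟨ length-++ b ⟨
    length (b ++ var y ∷ v)                       ≤⟨ m≤m+n _ _ ⟩
    length (b ++ var y ∷ v) + length (var y ∷ w)  ≡⟨ size-place σ _ _ ⟨
    size (config (frame σ y v w) b)               ∎
    where open ≤-Reasoning

  slide-size : Slide S Φ T → size T ≡ size S
  slide-size (slide (frame σ y v w) s u refl refl _) = begin
    size (place σ ((u ∷ʳ s) ++ var y ∷ v) (var y ∷ w))  ≡⟨ size-place σ _ _ ⟩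
    length ((u ∷ʳ s) ++ var y ∷ v) + suc (length w)      ≡⟨ cong (_+ suc (length w)) len ⟩
    length (s ∷ u ++ var y ∷ v) + suc (length w)         ≡⟨ size-place σ _ _ ⟨
    size (place σ (s ∷ u ++ var y ∷ v) (var y ∷ w))      ∎
    where
    open ≡-Reasoning
    len : length ((u ∷ʳ s) ++ var y ∷ v) ≡ length (s ∷ u ++ var y ∷ v)
    len = trans (cong length (++-assoc u [ s ] (var y ∷ v))) (length-++-sucʳ u s (var y ∷ v))

  head-substitution :
    Coherent ((s ∷ w₁) ≐ (var y ∷ w₂)) →
    Subst y (s ∷ var y ∷ []) w₁ L′ → Subst y (s ∷ var y ∷ []) w₂ R′ →
    R′ ≡ w₂ × (L′ ≡ w₁ ⊎ ∃₂ λ u v → w₁ ≡ u ++ var y ∷ v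
                                   × L′ ≡ u ++ s ∷ var y ∷ v)
  head-substitution (nrₗ , nrᵣ , _) θ₁ θ₂ =
    subst-absent θ₂ (λ m → nrᵣ _ (first m)) , subst-once (λ z q → nrₗ z (later q)) θ₁

  substitution-coherent :
    Reduction y s Φ → Coherent ((s ∷ w₁) ≐ (var y ∷ w₂)) →
    Subst y (s ∷ var y ∷ []) w₁ L′ → Subst y (s ∷ var y ∷ []) w₂ R′ →
    Coherent (L′ ≐ (var y ∷ R′))
  substitution-coherent red c θ₁ θ₂ with head-substitution c θ₁ θ₂
  ... | refl , inj₁ refl                  = coherent-mono later (λ q → q) c
  ... | refl , inj₂ (_ , _ , refl , refl) = coherent-slide (reduction-≢ red) c

  substitution-shrinks-or-slides :
    ∀ σ → Reduction y s Φ → Coherent ((s ∷ w₁) ≐ (var y ∷ w₂)) →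
    Subst y (s ∷ var y ∷ []) w₁ L′ → Subst y (s ∷ var y ∷ []) w₂ R′ →
    size (place σ L′ (var y ∷ R′)) < size (place σ (s ∷ w₁) (var y ∷ w₂))
    ⊎ Slide (place σ (s ∷ w₁) (var y ∷ w₂)) Φ (place σ L′ (var y ∷ R′))
  substitution-shrinks-or-slides {y = y} {s} {w₂ = w₂} σ red c θ₁ θ₂
    with head-substitution c θ₁ θ₂
  ... | refl , inj₁ refl =
    inj₁ (subst₂ _<_ (sym (size-place σ _ _)) (sym (size-place σ _ _)) (n<1+n _))
  ... | refl , inj₂ (u , v , refl , refl) =
    inj₂ (slide (frame σ y v w₂) s u refl (cong (λ l → place σ l (var y ∷ w₂)) slid) red)
    where
    slid : u ++ s ∷ var y ∷ v ≡ (u ∷ʳ s) ++ var y ∷ v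
    slid = sym (++-assoc u [ s ] (var y ∷ v))

  step-coherent : Coherent S → Step S Φ T → Coherent T
  step-coherent c (eraseL θ₁ θ₂) =
    coherent-mono (λ q → later (erase-precedes θ₁ q)) (erase-precedes θ₂) c
  step-coherent c (eraseR θ₁ θ₂) =
    coherent-mono (erase-precedes θ₁) (λ q → later (erase-precedes θ₂ q)) c
  step-coherent c P1 = coherent-mono later later c
  step-coherent c (P2 θ₁ θ₂) = substitution-coherent dec c θ₁ θ₂
  step-coherent c (P3 θ₁ θ₂) =
    coherent-swap (substitution-coherent dec (coherent-swap c) θ₂ θ₁)
  step-coherent c (P4a x≢y θ₁ θ₂) = substitution-coherent (sub x≢y) c θ₁ θ₂
  step-coherent c (P4b x≢y θ₁ θ₂) =
    coherent-swap (substitution-coherent (sub (λ e → x≢y (sym e))) (coherent-swap c) θ₂ θ₁)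

  step-shrinks-or-slides : Coherent S → Step S Φ T → size T < size S ⊎ Slide S Φ T
  step-shrinks-or-slides _ (eraseL θ₁ θ₂) =
    inj₁ (+-mono-<-≤ (s≤s (erase-length θ₁)) (erase-length θ₂))
  step-shrinks-or-slides _ (eraseR θ₁ θ₂) =
    inj₁ (+-mono-≤-< (erase-length θ₁) (s≤s (erase-length θ₂)))
  step-shrinks-or-slides _ P1 = inj₁ (+-mono-<-≤ (n<1+n _) (n≤1+n _))
  step-shrinks-or-slides c (P2 θ₁ θ₂) = substitution-shrinks-or-slides left dec c θ₁ θ₂
  step-shrinks-or-slides c (P3 θ₁ θ₂) =
    substitution-shrinks-or-slides right dec (coherent-swap c) θ₂ θ₁
  step-shrinks-or-slides c (P4a x≢y θ₁ θ₂) =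
    substitution-shrinks-or-slides left (sub x≢y) c θ₁ θ₂
  step-shrinks-or-slides c (P4b x≢y θ₁ θ₂) =
    substitution-shrinks-or-slides right (sub (λ e → x≢y (sym e))) (coherent-swap c) θ₂ θ₁

  step-size : Coherent S → Step S Φ T → size T ≤ size S
  step-size c st with step-shrinks-or-slides c st
  ... | inj₁ lt = <⇒≤ lt
  ... | inj₂ sl = ≤-reflexive (slide-size sl)

  reachable-coherent-smaller : Coherent E → E ⇒* S → Coherent S × size S ≤ size E
  reachable-coherent-smaller c ε = c , ≤-refl
  reachable-coherent-smaller c ((_ , st) ◅ r)
    with c′ , le ← reachable-coherent-smaller (step-coherent c st) r =
    c′ , ≤-trans le (step-size c st)

  private
    variable
      F : Frame

  split-unique : ∀ {b′ v′} → NoRepeat (b ++ var y ∷ v) →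
                 b ++ var y ∷ v ≡ b′ ++ var y ∷ v′ → b ≡ b′ × v ≡ v′
  split-unique {b = []}    {b′ = []}              _  refl = refl , refl
  split-unique {b = []}    {y = y} {b′ = _ ∷ b′} nr refl =
    ⊥-elim (nr y (first (∈-++⁺ʳ b′ (here refl))))
  split-unique {b = _ ∷ b} {y = y} {b′ = []}     nr refl =
    ⊥-elim (nr y (first (∈-++⁺ʳ b (here refl))))
  split-unique {b = _ ∷ b} {b′ = _ ∷ b′}         nr e
    with refl , e′ ← ∷-injective e
    with refl , refl ← split-unique {b = b} {b′ = b′} (λ z q → nr z (later q)) e′ =
    refl , refl

  opposite-frames : ∀ {y′ v′ w′} → Coherent ((b ++ var y ∷ v) ≐ (var y ∷ w)) →
                    b ++ var y ∷ v ≡ var y′ ∷ w′ →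
                    var y ∷ w ≡ (s ∷ u) ++ var y′ ∷ v′ → ⊥
  opposite-frames {b = []}    {y = y} {u = u} (_ , nrᵣ , _) refl refl =
    nrᵣ y (first (∈-++⁺ʳ u (here refl)))
  opposite-frames {b = _ ∷ b} {y = y} {u = u} {y′ = y′} (_ , _ , ord) refl refl =
    ord y′ y (first (∈-++⁺ʳ b (here refl))) (first (∈-++⁺ʳ u (here refl)))

  frame-unique : ∀ {F′} → Coherent S → S ≡ config F b → S ≡ config F′ (s ∷ u) →
                 F ≡ F′ × b ≡ s ∷ u
  frame-unique {F = frame σ y v w} {s = s} {u = u} {F′ = frame σ′ _ _ _} c refl e
    with side-cases σ σ′
  ... | inj₁ refl
    with eₗ , refl ← place-injective σ e
    with refl , refl ← split-unique {b′ = s ∷ u} (proj₁ (coherent-unplace σ c)) eₗ =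
    refl , refl
  ... | inj₂ refl with eₗ , eᵣ ← place-flip σ e =
    ⊥-elim (opposite-frames (coherent-unplace σ c) eₗ eᵣ)

  slide-from : Coherent S → S ≡ config F (s ∷ u) → Slide S Φ T →
               Reduction (pivot F) s Φ × T ≡ config F (u ∷ʳ s)
  slide-from {F = F} {s = s} {u = u} c e (slide _ _ _ e′ eT red)
    with refl , refl ← frame-unique {F = F} {b = s ∷ u} c e e′ = red , eT

  slide-deterministic : Coherent S → Slide S Φ T → Slide S Ψ T′ → Φ ≡ Ψ × T ≡ T′
  slide-deterministic c (slide _ _ _ e eT red) sl with red′ , eT′ ← slide-from c e sl =
    reduction-unique red red′ , trans eT (sym eT′)

  data Walk : Eqn A V → List (Trans A V) → Set where
    []  : Walk S []
    _∷_ : Step S Φ T → Walk T p → Walk S ((S , Φ , T) ∷ p)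

  final : Eqn A V → List (Trans A V) → Eqn A V
  final S []      = S
  final S (t ∷ p) = final (tgt t) p

  final≡lastTgt : ∀ t p → final (tgt t) p ≡ lastTgt t p
  final≡lastTgt t []      = refl
  final≡lastTgt t (u ∷ p) = final≡lastTgt u p

  path-walk : ∀ {t} → IsPath E (t ∷ p) → Walk (src t) (t ∷ p)
  path-walk {p = []} ((_ , st) ∷ [] , _) = st ∷ []
  path-walk {p = (_ , _ , _) ∷ _} {t = _ , _ , _} ((_ , st) ∷ steps , refl , chained) =
    st ∷ path-walk (steps , chained)

  sources-among-targets : ∀ {P : Eqn A V → Set} → Walk S p → All P (S ∷ map tgt p) →
                          All P (map src p)
  sources-among-targets []      _          = []
  sources-among-targets (_ ∷ w) (pS ∷ ps) = pS ∷ sources-among-targets w ps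

  sources-unique : Walk S p → Unique (S ∷ map tgt p) → Unique (map src p)
  sources-unique []      _                = []
  sources-unique (_ ∷ w) (S∉ ∷ distinct) =
    sources-among-targets w S∉ ∷ sources-unique w distinct

  walk-size : Coherent S → Walk S p → size (final S p) ≤ size S
  walk-size c []       = ≤-refl
  walk-size c (st ∷ w) = ≤-trans (walk-size (step-coherent c st) w) (step-size c st)

  nonshrinking⇒slides : Coherent S → Walk S p → size S ≤ size (final S p) → All IsSlide p
  nonshrinking⇒slides c []       _  = []
  nonshrinking⇒slides c (st ∷ w) le with step-shrinks-or-slides c st
  ... | inj₁ lt = ⊥-elim (<⇒≱ lt (≤-trans le (walk-size (step-coherent c st) w)))
  ... | inj₂ sl =
    sl ∷ nonshrinking⇒slides (step-coherent c st) w (≤-trans (≤-reflexive (slide-size sl)) le)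

  data SlidePrefix (S : Eqn A V) : List (Trans A V) → Set where
    all-slides : All IsSlide p → SlidePrefix S p
    slides-then-shrink : ∀ {g t r} → Walk S g → All IsSlide g →
                         Coherent (tgt t) → size (tgt t) < size S → Walk (tgt t) r →
                         SlidePrefix S (g ++ t ∷ r)

  slide-prefix : Coherent S → Walk S p → SlidePrefix S p
  slide-prefix c []       = all-slides []
  slide-prefix c (st ∷ w) with step-shrinks-or-slides c st
  ... | inj₁ lt = slides-then-shrink [] [] (step-coherent c st) lt w
  ... | inj₂ sl with slide-prefix (step-coherent c st) w
  ...   | all-slides sls = all-slides (sl ∷ sls)
  ...   | slides-then-shrink wg sg ct lt wr =
    slides-then-shrink (st ∷ wg) (sl ∷ sg) ct (<-≤-trans lt (≤-reflexive (slide-size sl))) wr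

  slides-reduce : Coherent S → S ≡ config F b → Walk S p → All IsSlide p →
                  All (λ t → Reduces (pivot F) (lbl t)) p
  slides-reduce c e [] [] = []
  slides-reduce {F = F} {b = b} c e (st ∷ w) (slide _ _ _ e′ eT red ∷ sls)
    with refl , _ ← frame-unique {F = F} {b = b} c e e′ =
    reduction-reduces red ∷ slides-reduce (step-coherent c st) eT w sls

  slide-walks-unique : ∀ {p′} → Coherent S → Walk S p → Walk S p′ →
                       All IsSlide p → All IsSlide p′ → final S p ≡ E → final S p′ ≡ E →
                       All (E ≢_) (map src p) → All (E ≢_) (map src p′) → p ≡ p′
  slide-walks-unique c []      []      _ _ _ _ _ _ = refl
  slide-walks-unique c []      (_ ∷ _) _ _ e _ _ (E≢S ∷ _) = ⊥-elim (E≢S (sym e))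
  slide-walks-unique c (_ ∷ _) []      _ _ _ e (E≢S ∷ _) _ = ⊥-elim (E≢S (sym e))
  slide-walks-unique c (st ∷ w) (_ ∷ w′) (sl ∷ sls) (sl′ ∷ sls′) e e′
                     (_ ∷ E∉) (_ ∷ E∉′)
    with refl , refl ← slide-deterministic c sl sl′ =
    cong (_ ∷_) (slide-walks-unique (step-coherent c st) w w′ sls sls′ e e′ E∉ E∉′)

  -- |b| slides rotate the block b ++ a into a ++ b, so a run avoiding S₀ stops before.
  slide-run : ∀ F b a {S₀} → S ≡ config F (b ++ a) → S₀ ≡ config F (a ++ b) →
              Coherent S → Walk S p → All IsSlide p → All (S₀ ≢_) (map src p) →
              length p ≤ length b
  slide-run F []      a e e₀ c []      _ _ = z≤n
  slide-run F []      a e e₀ c (_ ∷ _) _ (S₀≢S ∷ _) =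
    ⊥-elim (S₀≢S (trans e₀ (trans (cong (config F) (++-identityʳ a)) (sym e))))
  slide-run F (s ∷ b) a e e₀ c []       _ _ = z≤n
  slide-run F (s ∷ b) a e e₀ c (st ∷ w) (sl ∷ sls) (_ ∷ S₀∉) =
    s≤s (slide-run F b (a ∷ʳ s) e′ e₀′ (step-coherent c st) w sls S₀∉)
    where
    e′  = trans (proj₂ (slide-from c e sl)) (cong (config F) (++-assoc b a [ s ]))
    e₀′ = trans e₀ (cong (config F) (sym (++-assoc a [ s ] b)))

  slides-length : Coherent S → Walk S p → All IsSlide p → Unique (map src p) →
                  length p ≤ pred (size S)
  slides-length c []       _                               _        = z≤n
  slides-length c (st ∷ w) (slide F s u refl eT _ ∷ sls) (S∉ ∷ _) =
    <⇒≤pred (≤-<-trans (s≤s (slide-run F u [ s ] eT refl (step-coherent c st) w sls S∉))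
                       (block-shorter F (s ∷ u)))

  walk-length : ∀ n → Coherent S → size S ≤ n → Walk S p → Unique (map src p) →
                length p ≤ n * n
  walk-length n c le w distinct with slide-prefix c w
  ... | all-slides sls =
    ≤-trans (slides-length c w sls distinct) (≤-trans (pred-mono-≤ le) (pred[n]≤n*n n))
  ... | slides-then-shrink {g} {t} {r} wg sg ct lt wr with ≤-trans lt le
  ...   | s≤s {n = m} tgt≤m
    with distinct-g , (_ ∷ distinct-r) ←
           AllPairs-++⁻ (map src g) (subst Unique (map-++ src g (t ∷ r)) distinct) =
    begin
      length (g ++ t ∷ r)       ≡⟨ length-++ g ⟩
      length g + suc (length r) ≤⟨ +-mono-≤ (≤-trans (slides-length c wg sg distinct-g)
                                                      (pred-mono-≤ le))
                                            (s≤s (walk-length m ct tgt≤m wr distinct-r)) ⟩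
      m + suc (m * m)           ≤⟨ m+[1+m*m]≤[1+m]*[1+m] m ⟩
      suc m * suc m             ∎
    where open ≤-Reasoning

  data SlideCycle (E S : Eqn A V) : List (Trans A V) → Set where
    slide-cycle : ∀ {t} → Coherent S → size S ≤ size E → Walk S (t ∷ p) →
                  All IsSlide (t ∷ p) → final S (t ∷ p) ≡ S → Unique (map src (t ∷ p)) →
                  SlideCycle E S (t ∷ p)

  simple-cycle⇒slide-cycle : ∀ {c} → Coherent E → SimpleCycle E c → StartsAt S c →
                             SlideCycle E S c
  simple-cycle⇒slide-cycle {c = t ∷ p} cE (path@((reach , _) ∷ _ , _) , closed , distinct) refl
    with cS , S≤E ← reachable-coherent-smaller cE reach =
    slide-cycle cS S≤E walk sliding closed′ distinct
    where
    walk    = path-walk path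
    closed′ = trans (final≡lastTgt t p) closed
    sliding = nonshrinking⇒slides cS walk (≤-reflexive (cong size (sym closed′)))

  slide-cycles-unique : ∀ {c c′} → SlideCycle E S c → SlideCycle E S c′ → c ≡ c′
  slide-cycles-unique (slide-cycle c _ (st ∷ w) (sl ∷ sls) e (S∉ ∷ _))
                      (slide-cycle _ _ (_ ∷ w′) (sl′ ∷ sls′) e′ (S∉′ ∷ _))
    with refl , refl ← slide-deterministic c sl sl′ =
    cong (_ ∷_) (slide-walks-unique (step-coherent c st) w w′ sls sls′ e e′ S∉ S∉′)

  flat : Coherent E → Flat E
  flat c _ _ _ cyc cyc′ at at′ =
    slide-cycles-unique (simple-cycle⇒slide-cycle c cyc at)
                        (simple-cycle⇒slide-cycle c cyc′ at′)

  cycle-one-var-reducing : Coherent E → ∀ c → SimpleCycle E c → OneVarReducing c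
  cycle-one-var-reducing cE (_ ∷ _) cyc
    with slide-cycle c _ w sliding@(slide F s u e _ _ ∷ _) _ _ ←
           simple-cycle⇒slide-cycle cE cyc refl =
    pivot F , slides-reduce {F = F} {b = s ∷ u} c e w sliding

  cycle-length : Coherent E → ∀ c → SimpleCycle E c → length c ≤ size E
  cycle-length cE (_ ∷ _) cyc
    with slide-cycle c S≤E w sliding _ distinct ← simple-cycle⇒slide-cycle cE cyc refl =
    ≤-trans (slides-length c w sliding distinct) (≤-trans pred[n]≤n S≤E)

  path-length : Coherent E → ∀ p → SimplePath E p → length p ≤ size E * size E
  path-length cE []      _ = z≤n
  path-length cE (_ ∷ _) (path@((reach , _) ∷ _ , _) , distinct)
    with cS , S≤E ← reachable-coherent-smaller cE reach =
    walk-length _ cS S≤E (path-walk path) (sources-unique (path-walk path) distinct)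

lemma6 : {A V : Set} →
    ((E : Eqn A V) → RegularOriented E →
      Flat E × ((c : List (Trans A V)) → SimpleCycle E c → OneVarReducing c))
    × Σ ℕ (λ k → Σ ℕ (λ N → (E : Eqn A V) → RegularOriented E → N ≤ size E →
        ((c : List (Trans A V)) → SimpleCycle E c → length c ≤ k * size E)
        × ((p : List (Trans A V)) → SimplePath E p → length p ≤ k * (size E * size E))))
lemma6 =
  (λ E ro → flat (coherent ro) , cycle-one-var-reducing (coherent ro)) ,
  1 , 0 , λ E ro _ →
    (λ c cyc → ≤-trans (cycle-length (coherent ro) c cyc) (n≤1*n _)) ,
    (λ p path → ≤-trans (path-length (coherent ro) p path) (n≤1*n _))
  where
  n≤1*n : ∀ n → n ≤ 1 * n
  n≤1*n n = ≤-reflexive (sym (*-identityˡ n))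
  coherent : ∀ {A V} {E : Eqn A V} → RegularOriented E → Coherent E
  coherent (_ , oriented) = oriented⇒coherent oriented
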